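{- For all $n\ge0$, $|S_n(123,2143,3214)|=p_n$, where $p_0=1$, $p_1=1$, $p_2=2$ and $p_n=2p_{n-1}+p_{n-2}$ for $n\ge3$ (Pell numbers $1,1,2,5,12,29,70,\dots$).
   Context: $S_n$ is the set of permutations of $\{1,\dots,n\}$; $S_0$ contains only the empty permutation. A permutation $\pi$ contains a pattern $\gamma\in S_m$ if some subsequence of $\pi$ of length $m$ is order-isomorphic to $\gamma$; otherwise $\pi$ avoids $\gamma$. $S_n(\gamma_1,\dots,\gamma_r)$ is the set of permutations in $S_n$ avoiding every $\gamma_i$. -}

module Defs where

open import Data.Nat using (ℕ; zero; suc; _+_; _*_; _<ᵇ_; _≡ᵇ_)
open import Data.Bool using (Bool; true; false; _∧_; not; _xor_)
open import Data.List using (List; []; _∷_; map; _++_)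
open import Data.Bool.ListAction using (all; any)
open import Data.Fin using (Fin; toℕ)
open import Data.Vec using (Vec; toList)

pell : ℕ → ℕ
pell zero = 1
pell (suc zero) = 1
pell (suc (suc zero)) = 2
pell (suc (suc (suc n))) = 2 * pell (suc (suc n)) + pell (suc n)

_==_ : Bool → Bool → Bool
p == q = not (p xor q)

distinct : List ℕ → Bool
distinct [] = true
distinct (x ∷ xs) = all (λ y → not (x ≡ᵇ y)) xs ∧ distinct xs

-- A permutation of {1,…,n} is represented (0-based) in one-line notation:
-- a vector of length n with entries in Fin n, no entry repeated.
isPerm : ∀ {n} → Vec (Fin n) n → Bool
isPerm v = distinct (map toℕ (toList v))

subseqs : List ℕ → List (List ℕ)
subseqs [] = [] ∷ []
subseqs (x ∷ xs) = map (x ∷_) (subseqs xs) ++ subseqs xs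

headAgrees : ℕ → List ℕ → ℕ → List ℕ → Bool
headAgrees a (x ∷ xs) b (y ∷ ys) =
  ((a <ᵇ x) == (b <ᵇ y)) ∧ ((x <ᵇ a) == (y <ᵇ b)) ∧ headAgrees a xs b ys
headAgrees _ _ _ _ = true

orderIso : List ℕ → List ℕ → Bool
orderIso [] [] = true
orderIso (x ∷ xs) (y ∷ ys) = headAgrees x xs y ys ∧ orderIso xs ys
orderIso _ _ = false

contains : List ℕ → List ℕ → Bool
contains π γ = any (λ s → orderIso s γ) (subseqs π)

avoids : List ℕ → List ℕ → Bool
avoids π γ = not (contains π γ)

-- membership in S_n(123, 2143, 3214)  (patterns written 1-based as in the paper)
inS-123-2143-3214 : ∀ {n} → Vec (Fin n) n → Bool
inS-123-2143-3214 v =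
  isPerm v
  ∧ avoids π (1 ∷ 2 ∷ 3 ∷ [])
  ∧ avoids π (2 ∷ 1 ∷ 4 ∷ 3 ∷ [])
  ∧ avoids π (3 ∷ 2 ∷ 1 ∷ 4 ∷ [])
  where π = map toℕ (toList v)

-- Write M = 2 + n for the largest value of a permutation π ∈ S(3 + n) (values are 0-based).
-- Two entries before M would form 123 with M unless they decrease, and three decreasing
-- entries before M would form 3214; so M is among the first three entries. If it is third,
-- π = x y M ⋯ with y < x, and x must be the second largest value 1 + n: otherwise 1 + n
-- comes after M and x y M (1 + n) is a 2143. Conversely each of the three insertions
-- M σ, a M σ and (1 + n) b M τ preserves avoidance, and deleting the inserted maxima
-- inverts them. Hence S(3 + n) ≅ S(2 + n) ⊎ S(2 + n) ⊎ S(1 + n), the Pell recursion.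

{-# OPTIONS --safe #-}
module Submission where

open import Defs
open import Data.Bool using (Bool; true; false; _∧_; not; T)
open import Data.Bool.Properties using (T-∧; T-≡; T-irrelevant; ¬-not)
open import Data.Nat using (ℕ; zero; suc; _+_; _*_; _<ᵇ_; _≡ᵇ_; _<_; _≤_; z≤n; s≤s; s≤s⁻¹)
open import Data.Nat.Properties
open import Data.List using (List; []; _∷_; _++_; map; length; take; drop)
open import Data.List.Properties using (length-++-sucʳ)
open import Data.List.Relation.Unary.All as All using (All; []; _∷_)
open import Data.List.Relation.Unary.All.Properties using (all⁺; all⁻; ++⁺; ++⁻; ¬Any⇒All¬)
open import Data.List.Relation.Unary.Any using (Any; here; there)
import Data.List.Relation.Unary.Any.Properties as Any
open import Data.List.Relation.Unary.AllPairs using ([]; _∷_)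
open import Data.List.Relation.Unary.Unique.Propositional using (Unique)
open import Data.List.Relation.Binary.Pointwise using (Pointwise; []; _∷_)
open import Data.List.Relation.Binary.Sublist.Propositional
  using (_⊆_; []; _∷_; _∷ʳ_; ⊆-refl; ⊆-trans; minimum; from∈)
import Data.List.Relation.Binary.Sublist.Propositional.Properties as Sublist
open import Data.List.Membership.Propositional using (_∈_)
open import Data.List.Membership.Propositional.Properties using (∈-∃++; ∈-insert)
open import Data.List.Membership.DecPropositional _≟_ using (_∈?_)
open import Data.Fin using (Fin; zero; suc; toℕ; fromℕ<)
open import Data.Fin.Properties using (+↔⊎; toℕ<n; toℕ-fromℕ<; fromℕ<-toℕ)
open import Data.Vec using (Vec; toList; []; _∷_)
open import Data.Product using (Σ; ∃; _×_; _,_; proj₁; proj₂; swap)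
open import Data.Product.Algebra using (Σ-assoc-alt)
open import Data.Product.Function.Dependent.Propositional using (Σ-↔)
open import Data.Sum using (_⊎_; inj₁; inj₂)
open import Data.Sum.Function.Propositional using (_⊎-↔_)
open import Data.Empty using (⊥-elim)
open import Data.Unit using (⊤; tt)
open import Function using (_∘_)
open import Function.Bundles using (_⇔_; mk⇔; module Equivalence; _↔_; mk↔ₛ′)
open import Function.Properties.Inverse using (↔-refl; ↔-sym; ↔-trans)
open import Relation.Nullary using (¬_; yes; no)
open import Relation.Nullary.Irrelevant using (Irrelevant)
open import Relation.Binary.Definitions using (tri<; tri≈; tri>)
open import Relation.Binary.PropositionalEquality
  using (_≡_; _≢_; refl; sym; trans; cong; cong₂; subst; ≢-sym)

open Equivalence using (to; from)

T-not : ∀ {b} → T (not b) ⇔ (¬ T b)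
T-not {true}  = mk⇔ (λ ()) (λ ¬t → ¬t tt)
T-not {false} = mk⇔ (λ _ ()) (λ _ → tt)

T-== : ∀ {p q} → T (p == q) ⇔ (p ≡ q)
T-== {true}  {true}  = mk⇔ (λ _ → refl) (λ _ → tt)
T-== {true}  {false} = mk⇔ (λ ()) (λ ())
T-== {false} {true}  = mk⇔ (λ ()) (λ ())
T-== {false} {false} = mk⇔ (λ _ → refl) (λ _ → tt)

T-not-≡ᵇ : ∀ {m n} → T (not (m ≡ᵇ n)) ⇔ (m ≢ n)
T-not-≡ᵇ {m} {n} = mk⇔ (λ t → to T-not t ∘ ≡⇒≡ᵇ m n) (λ m≢n → from T-not (m≢n ∘ ≡ᵇ⇒≡ m n))

distinct⇔Unique : ∀ l → T (distinct l) ⇔ Unique l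
distinct⇔Unique []      = mk⇔ (λ _ → []) (λ _ → tt)
distinct⇔Unique (x ∷ l) = mk⇔
  (λ t → let (fresh , rest) = to T-∧ t in
    All.map (to T-not-≡ᵇ) (all⁺ _ l fresh) ∷ to (distinct⇔Unique l) rest)
  (λ { (fresh ∷ rest) →
    from T-∧ (all⁻ _ (All.map (from T-not-≡ᵇ) fresh) , from (distinct⇔Unique l) rest) })

SameOrder : ℕ → ℕ → ℕ → ℕ → Set
SameOrder a x g y = ((a <ᵇ x) ≡ (g <ᵇ y)) × ((x <ᵇ a) ≡ (y <ᵇ g))

data OrderIso : List ℕ → List ℕ → Set where
  []  : OrderIso [] []
  _∷_ : ∀ {a g xs ys} → Pointwise (λ x y → SameOrder a x g y) xs ys → OrderIso xs ys →
        OrderIso (a ∷ xs) (g ∷ ys)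

headAgrees⇒Pointwise : ∀ {a g xs ys} → OrderIso xs ys → T (headAgrees a xs g ys) →
                       Pointwise (λ x y → SameOrder a x g y) xs ys
headAgrees⇒Pointwise []        _ = []
headAgrees⇒Pointwise (_ ∷ iso) t =
  let (lt , t′) = to T-∧ t ; (gt , rest) = to T-∧ t′ in
  (to T-== lt , to T-== gt) ∷ headAgrees⇒Pointwise iso rest

Pointwise⇒headAgrees : ∀ {a g xs ys} → Pointwise (λ x y → SameOrder a x g y) xs ys →
                       T (headAgrees a xs g ys)
Pointwise⇒headAgrees []               = tt
Pointwise⇒headAgrees ((lt , gt) ∷ ps) =
  from T-∧ (from T-== lt , from T-∧ (from T-== gt , Pointwise⇒headAgrees ps))

orderIso⇔OrderIso : ∀ s γ → T (orderIso s γ) ⇔ OrderIso s γ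
orderIso⇔OrderIso s γ = mk⇔ (sound s γ) complete
  where
  sound : ∀ s γ → T (orderIso s γ) → OrderIso s γ
  sound []      []      _ = []
  sound (a ∷ s) (g ∷ γ) t =
    let (head , tail) = to T-∧ t ; iso = sound s γ tail in
    headAgrees⇒Pointwise iso head ∷ iso
  complete : ∀ {s γ} → OrderIso s γ → T (orderIso s γ)
  complete []          = tt
  complete (row ∷ iso) = from T-∧ (Pointwise⇒headAgrees row , complete iso)

-- For literal pattern entries g < y, SameOrder a x g y computes to the type of ascending.
ascending : ∀ {a x} → a < x → ((a <ᵇ x) ≡ true) × ((x <ᵇ a) ≡ false)
ascending {a} {x} a<x = to T-≡ (<⇒<ᵇ a<x) , ¬-not (λ x<ᵇa → <-asym a<x (<ᵇ⇒< x a (from T-≡ x<ᵇa)))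

descending : ∀ {a x} → x < a → ((a <ᵇ x) ≡ false) × ((x <ᵇ a) ≡ true)
descending = swap ∘ ascending

occurrence-123 : ∀ {a b c} → a < b → b < c → OrderIso (a ∷ b ∷ c ∷ []) (1 ∷ 2 ∷ 3 ∷ [])
occurrence-123 a<b b<c =
  (ascending a<b ∷ ascending (<-trans a<b b<c) ∷ []) ∷ (ascending b<c ∷ []) ∷ [] ∷ []

occurrence-2143 : ∀ {a b c d} → b < a → a < d → d < c →
                  OrderIso (a ∷ b ∷ c ∷ d ∷ []) (2 ∷ 1 ∷ 4 ∷ 3 ∷ [])
occurrence-2143 b<a a<d d<c =
  (descending b<a ∷ ascending a<c ∷ ascending a<d ∷ []) ∷
  (ascending b<c ∷ ascending b<d ∷ []) ∷ (descending d<c ∷ []) ∷ [] ∷ []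
  where
  a<c = <-trans a<d d<c
  b<d = <-trans b<a a<d
  b<c = <-trans b<d d<c

occurrence-3214 : ∀ {a b c d} → c < b → b < a → a < d →
                  OrderIso (a ∷ b ∷ c ∷ d ∷ []) (3 ∷ 2 ∷ 1 ∷ 4 ∷ [])
occurrence-3214 c<b b<a a<d =
  (descending b<a ∷ descending c<a ∷ ascending a<d ∷ []) ∷
  (descending c<b ∷ ascending b<d ∷ []) ∷ (ascending c<d ∷ []) ∷ [] ∷ []
  where
  c<a = <-trans c<b b<a
  b<d = <-trans b<a a<d
  c<d = <-trans c<b b<d

-- Stated with _<ᵇ_ so that on literal patterns it computes and is refuted by absurd patterns.
HeadIsMax : List ℕ → Set
HeadIsMax []       = ⊤
HeadIsMax (g ∷ ys) = All (λ y → T (y <ᵇ g)) ys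

Pointwise-headIsMax : ∀ {a g xs ys} → Pointwise (λ x y → SameOrder a x g y) xs ys →
                      All (_< a) xs → All (λ y → T (y <ᵇ g)) ys
Pointwise-headIsMax []               []           = []
Pointwise-headIsMax ((_ , gt) ∷ row) (x<a ∷ xs<a) =
  subst T gt (<⇒<ᵇ x<a) ∷ Pointwise-headIsMax row xs<a

OrderIso-headIsMax : ∀ {a xs γ} → OrderIso (a ∷ xs) γ → All (_< a) xs → HeadIsMax γ
OrderIso-headIsMax (row ∷ _) = Pointwise-headIsMax row

Any-subseqs⁻ : ∀ {P : List ℕ → Set} l → Any P (subseqs l) → ∃ λ s → s ⊆ l × P s
Any-subseqs⁻ []      (here p) = [] , [] , p
Any-subseqs⁻ (x ∷ l) p∈ with Any.++⁻ (map (x ∷_) (subseqs l)) p∈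
... | inj₁ kept    = let (s , s⊆l , p) = Any-subseqs⁻ l (Any.map⁻ kept) in x ∷ s , refl ∷ s⊆l , p
... | inj₂ skipped = let (s , s⊆l , p) = Any-subseqs⁻ l skipped in s , x ∷ʳ s⊆l , p

Any-subseqs⁺ : ∀ {P : List ℕ → Set} {s l} → s ⊆ l → P s → Any P (subseqs l)
Any-subseqs⁺ []                       p = here p
Any-subseqs⁺ {l = x ∷ l} (x ∷ʳ s⊆l) p = Any.++⁺ʳ (map (x ∷_) (subseqs l)) (Any-subseqs⁺ s⊆l p)
Any-subseqs⁺ (refl ∷ s⊆l)             p = Any.++⁺ˡ (Any.map⁺ (Any-subseqs⁺ s⊆l p))

Avoids : List ℕ → List ℕ → Set
Avoids l γ = ∀ {s} → s ⊆ l → ¬ OrderIso s γ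

avoids⇔Avoids : ∀ l γ → T (avoids l γ) ⇔ Avoids l γ
avoids⇔Avoids l γ = mk⇔
  (λ av {s} s⊆l iso →
    to T-not av (Any.any⁺ _ (Any-subseqs⁺ s⊆l (from (orderIso⇔OrderIso s γ) iso))))
  (λ av → from T-not λ occ →
    let (s , s⊆l , t) = Any-subseqs⁻ l (Any.any⁻ _ _ occ) in av s⊆l (to (orderIso⇔OrderIso s γ) t))

Avoids-resp-⊆ : ∀ {l l′ γ} → l′ ⊆ l → Avoids l γ → Avoids l′ γ
Avoids-resp-⊆ l′⊆l av s⊆l′ = av (⊆-trans s⊆l′ l′⊆l)

Avoids-max-first : ∀ {γ m σ} → ¬ HeadIsMax γ → All (_< m) σ → Avoids σ γ → Avoids (m ∷ σ) γ
Avoids-max-first _    _   av (_ ∷ʳ s⊆σ)        = av s⊆σ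
Avoids-max-first ¬max σ<m _  (refl ∷ s⊆σ) iso =
  ¬max (OrderIso-headIsMax iso (Sublist.All-resp-⊆ s⊆σ σ<m))

Avoids-max-second : ∀ {γ a m σ} → ¬ HeadIsMax γ → ¬ HeadIsMax (drop 1 γ) → All (_< m) σ →
                    Avoids (a ∷ σ) γ → Avoids (a ∷ m ∷ σ) γ
Avoids-max-second ¬max₀ _ σ<m av (_ ∷ʳ s⊆) =
  Avoids-max-first ¬max₀ σ<m (Avoids-resp-⊆ (_ ∷ʳ ⊆-refl) av) s⊆
Avoids-max-second _ _ _ av (refl ∷ (_ ∷ʳ s⊆)) = av (refl ∷ s⊆)
Avoids-max-second _ ¬max₁ σ<m _ (refl ∷ (refl ∷ s⊆)) (_ ∷ iso) =
  ¬max₁ (OrderIso-headIsMax iso (Sublist.All-resp-⊆ s⊆ σ<m))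

Avoids-max-third : ∀ {γ m b τ} →
                   ¬ HeadIsMax γ → ¬ HeadIsMax (drop 1 γ) → ¬ HeadIsMax (take 2 γ ++ drop 3 γ) →
                   b < m → All (_< m) τ → Avoids (m ∷ b ∷ τ) γ → Avoids (m ∷ b ∷ suc m ∷ τ) γ
Avoids-max-third ¬max₀ ¬max₁ _ _ τ<m av (_ ∷ʳ s⊆) =
  Avoids-max-second ¬max₀ ¬max₁ (All.map m<n⇒m<1+n τ<m) (Avoids-resp-⊆ (_ ∷ʳ ⊆-refl) av) s⊆
Avoids-max-third ¬max₀ ¬max₁ _ _ τ<m av (refl ∷ (_ ∷ʳ s⊆)) =
  Avoids-max-second ¬max₀ ¬max₁ (All.map m<n⇒m<1+n τ<m) (Avoids-resp-⊆ (refl ∷ _ ∷ʳ ⊆-refl) av)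
    (refl ∷ s⊆)
Avoids-max-third _ _ _ _ _ av (refl ∷ (refl ∷ (_ ∷ʳ s⊆))) = av (refl ∷ refl ∷ s⊆)
Avoids-max-third _ _ ¬max₂ b<m τ<m _ (refl ∷ (refl ∷ (refl ∷ s⊆))) ((b~y₁ ∷ _ ∷ row) ∷ _) =
  ¬max₂ (Pointwise-headIsMax (b~y₁ ∷ row) (b<m ∷ Sublist.All-resp-⊆ s⊆ τ<m))

All-++-∷ : ∀ {P : ℕ → Set} u {m v} → All P (u ++ m ∷ v) ⇔ (P m × All P (u ++ v))
All-++-∷ u = mk⇔
  (λ all → let (pu , pmv) = ++⁻ u all in All.head pmv , ++⁺ pu (All.tail pmv))
  (λ (pm , all) → let (pu , pv) = ++⁻ u all in ++⁺ pu (pm ∷ pv))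

Unique-++-∷ : ∀ u {m v} → Unique (u ++ m ∷ v) ⇔ (All (m ≢_) (u ++ v) × Unique (u ++ v))
Unique-++-∷ []      = mk⇔ (λ { (m∉v ∷ v!) → m∉v , v! }) (λ (m∉v , v!) → m∉v ∷ v!)
Unique-++-∷ (x ∷ u) = mk⇔
  (λ { (x∉ ∷ rest) →
    let (x≢m , x∉′) = to (All-++-∷ u) x∉ ; (m∉ , rest′) = to (Unique-++-∷ u) rest in
    ≢-sym x≢m ∷ m∉ , x∉′ ∷ rest′ })
  (λ { (m≢x ∷ m∉ , x∉′ ∷ rest′) →
    from (All-++-∷ u) (≢-sym m≢x , x∉′) ∷ from (Unique-++-∷ u) (m∉ , rest′) })

All<suc∧≢⇒All< : ∀ {m l} → All (_< suc m) l → All (m ≢_) l → All (_< m) l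
All<suc∧≢⇒All< l<1+m m∉l =
  All.zipWith (λ (x<1+m , m≢x) → ≤∧≢⇒< (s≤s⁻¹ x<1+m) (≢-sym m≢x)) (l<1+m , m∉l)

Unique∧All<-deleteMax : ∀ u {m v} → Unique (u ++ m ∷ v) → All (_< suc m) (u ++ m ∷ v) →
                        Unique (u ++ v) × All (_< m) (u ++ v)
Unique∧All<-deleteMax u uniq bnd =
  let (m∉ , uniq′) = to (Unique-++-∷ u) uniq in
  uniq′ , All<suc∧≢⇒All< (proj₂ (to (All-++-∷ u) bnd)) m∉

Unique∧All<⇒length≤ : ∀ n {l} → Unique l → All (_< n) l → length l ≤ n
Unique∧All<⇒length≤ zero    {[]}    _    _        = z≤n
Unique∧All<⇒length≤ zero    {_ ∷ _} _    (() ∷ _)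
Unique∧All<⇒length≤ (suc n) {l}     uniq bnd with n ∈? l
... | no n∉l = m≤n⇒m≤1+n (Unique∧All<⇒length≤ n uniq (All<suc∧≢⇒All< bnd (¬Any⇒All¬ l n∉l)))
... | yes n∈l with ∈-∃++ n∈l
...   | u , v , refl =
  let (uniq′ , bnd′) = Unique∧All<-deleteMax u uniq bnd in
  ≤-trans (≤-reflexive (length-++-sucʳ u n v)) (s≤s (Unique∧All<⇒length≤ n uniq′ bnd′))

record IsPermutation (n : ℕ) (l : List ℕ) : Set where
  constructor permutation
  field
    length≡ : length l ≡ n
    bounded : All (_< n) l
    unique  : Unique l

IsPermutation⇒∈ : ∀ {n l k} → IsPermutation n l → k < n → k ∈ l
IsPermutation⇒∈ {n} {l} {k} (permutation length≡ bnd uniq) k<n with k ∈? l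
... | yes k∈l = k∈l
... | no  k∉l =
  ⊥-elim (<-irrefl length≡ (Unique∧All<⇒length≤ n (¬Any⇒All¬ l k∉l ∷ uniq) (k<n ∷ bnd)))

IsPermutation-insert : ∀ u {m v} → IsPermutation m (u ++ v) → IsPermutation (suc m) (u ++ m ∷ v)
IsPermutation-insert u {m} {v} (permutation length≡ bnd uniq) = permutation
  (trans (length-++-sucʳ u m v) (cong suc length≡))
  (from (All-++-∷ u) (n<1+n m , All.map m<n⇒m<1+n bnd))
  (from (Unique-++-∷ u) (All.map >⇒≢ bnd , uniq))

IsPermutation-delete : ∀ u {m v} → IsPermutation (suc m) (u ++ m ∷ v) → IsPermutation m (u ++ v)
IsPermutation-delete u {m} {v} (permutation length≡ bnd uniq) =
  let (uniq′ , bnd′) = Unique∧All<-deleteMax u uniq bnd in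
  permutation (suc-injective (trans (sym (length-++-sucʳ u m v)) length≡)) bnd′ uniq′

forbidden : List (List ℕ)
forbidden = (1 ∷ 2 ∷ 3 ∷ []) ∷ (2 ∷ 1 ∷ 4 ∷ 3 ∷ []) ∷ (3 ∷ 2 ∷ 1 ∷ 4 ∷ []) ∷ []

-- The hypotheses of Avoids-max-first/second/third: a newly inserted maximum cannot be the
-- first or second entry of an occurrence of γ, nor its third entry after a dominating first one.
MaxExtendable : List ℕ → Set
MaxExtendable γ = ¬ HeadIsMax γ × ¬ HeadIsMax (drop 1 γ) × ¬ HeadIsMax (take 2 γ ++ drop 3 γ)

forbidden-maxExtendable : All MaxExtendable forbidden
forbidden-maxExtendable =
  ((λ { (() ∷ _) })         , (λ { (() ∷ _) })     , (λ { (() ∷ _) }))     ∷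
  ((λ { (_ ∷ () ∷ _) })     , (λ { (() ∷ _) })     , (λ { (_ ∷ () ∷ _) })) ∷
  ((λ { (_ ∷ _ ∷ () ∷ _) }) , (λ { (_ ∷ () ∷ _) }) , (λ { (_ ∷ () ∷ _) })) ∷ []

record InS (n : ℕ) (l : List ℕ) : Set where
  constructor inS
  field
    isPermutation : IsPermutation n l
    avoiding      : All (Avoids l) forbidden
open InS

InS-delete : ∀ u {m v} → InS (suc m) (u ++ m ∷ v) → InS m (u ++ v)
InS-delete u (inS perm av) =
  inS (IsPermutation-delete u perm)
      (All.map (Avoids-resp-⊆ (Sublist.++⁺ (⊆-refl {x = u}) (_ ∷ʳ ⊆-refl))) av)

InS-max-first : ∀ {m σ} → InS m σ → InS (suc m) (m ∷ σ)
InS-max-first {m} {σ} (inS perm av) =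
  inS (IsPermutation-insert [] perm) (All.zipWith extend (forbidden-maxExtendable , av))
  where
  extend : ∀ {γ} → MaxExtendable γ × Avoids σ γ → Avoids (m ∷ σ) γ
  extend ((¬max₀ , _) , avγ) = Avoids-max-first ¬max₀ (IsPermutation.bounded perm) avγ

InS-max-second : ∀ {m a σ} → InS m (a ∷ σ) → InS (suc m) (a ∷ m ∷ σ)
InS-max-second {m} {a} {σ} (inS perm av) =
  inS (IsPermutation-insert (a ∷ []) perm) (All.zipWith extend (forbidden-maxExtendable , av))
  where
  extend : ∀ {γ} → MaxExtendable γ × Avoids (a ∷ σ) γ → Avoids (a ∷ m ∷ σ) γ
  extend ((¬max₀ , ¬max₁ , _) , avγ) =
    Avoids-max-second ¬max₀ ¬max₁ (All.tail (IsPermutation.bounded perm)) avγ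

InS-max-third : ∀ {m b τ} → InS m (b ∷ τ) → InS (suc (suc m)) (m ∷ b ∷ suc m ∷ τ)
InS-max-third {m} {b} {τ} p@(inS (permutation _ (b<m ∷ τ<m) _) _) =
  inS (IsPermutation-insert (m ∷ b ∷ []) (isPermutation mbτ))
      (All.zipWith extend (forbidden-maxExtendable , avoiding mbτ))
  where
  mbτ = InS-max-first p
  extend : ∀ {γ} → MaxExtendable γ × Avoids (m ∷ b ∷ τ) γ → Avoids (m ∷ b ∷ suc m ∷ τ) γ
  extend ((¬max₀ , ¬max₁ , ¬max₂) , avγ) = Avoids-max-third ¬max₀ ¬max₁ ¬max₂ b<m τ<m avγ

max-not-after-third : ∀ {n x y z u v} → ¬ InS (3 + n) (x ∷ y ∷ z ∷ u ++ 2 + n ∷ v)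
max-not-after-third {n} {x} {y} {z} {u} p
  with InS-delete (x ∷ y ∷ z ∷ u) p | avoiding p
... | inS (permutation _ (x<M ∷ y<M ∷ z<M ∷ _) ((x≢y ∷ _) ∷ (y≢z ∷ _) ∷ _)) _
    | av₁₂₃ ∷ _ ∷ av₃₂₁₄ ∷ []
  with <-cmp x y | <-cmp y z
... | tri< x<y _ _ | _ =
  av₁₂₃ (refl ∷ refl ∷ _ ∷ʳ from∈ (∈-insert u)) (occurrence-123 x<y y<M)
... | tri≈ _ x≡y _ | _ = x≢y x≡y
... | tri> _ _ _   | tri< y<z _ _ =
  av₁₂₃ (_ ∷ʳ refl ∷ refl ∷ from∈ (∈-insert u)) (occurrence-123 y<z z<M)
... | tri> _ _ _   | tri≈ _ y≡z _ = y≢z y≡z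
... | tri> _ _ y<x | tri> _ _ z<y =
  av₃₂₁₄ (refl ∷ refl ∷ refl ∷ from∈ (∈-insert u)) (occurrence-3214 z<y y<x x<M)

max-third⇒head≡1+n : ∀ {n x y v} → InS (3 + n) (x ∷ y ∷ 2 + n ∷ v) → x ≡ 1 + n
max-third⇒head≡1+n {n} {x} {y} {v} p
  with InS-delete (x ∷ y ∷ []) p | avoiding p
... | xyv@(inS (permutation _ (x<M ∷ y<M ∷ _) ((x≢y ∷ x∉v) ∷ _)) _) | av₁₂₃ ∷ av₂₁₄₃ ∷ _ ∷ []
  with <-cmp x y | IsPermutation⇒∈ (isPermutation xyv) (n<1+n (1 + n))
... | tri< x<y _ _ | _ = ⊥-elim (av₁₂₃ (refl ∷ refl ∷ refl ∷ minimum v) (occurrence-123 x<y y<M))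
... | tri≈ _ x≡y _ | _ = ⊥-elim (x≢y x≡y)
... | tri> _ _ _   | here 1+n≡x        = sym 1+n≡x
... | tri> _ _ y<x | there (here refl) = ⊥-elim (<⇒≱ y<x (s≤s⁻¹ x<M))
... | tri> _ _ y<x | there (there 1+n∈v) =
  ⊥-elim (av₂₁₄₃ (refl ∷ refl ∷ refl ∷ from∈ 1+n∈v) (occurrence-2143 y<x x<1+n (n<1+n (1 + n))))
  where x<1+n = ≤∧≢⇒< (s≤s⁻¹ x<M) (All.lookup x∉v 1+n∈v)

data MaxPosition (n : ℕ) : List ℕ → Set where
  first  : ∀ σ   → MaxPosition n (2 + n ∷ σ)
  second : ∀ a σ → MaxPosition n (a ∷ 2 + n ∷ σ)
  third  : ∀ b τ → MaxPosition n (1 + n ∷ b ∷ 2 + n ∷ τ)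

maxPosition : ∀ {n l} → InS (3 + n) l → MaxPosition n l
maxPosition {n} p with ∈-∃++ (IsPermutation⇒∈ (isPermutation p) (n<1+n (2 + n)))
... | []            , v , refl = first v
... | a ∷ []        , v , refl = second a v
... | _ ∷ _ ∷ _ ∷ _ , _ , refl = ⊥-elim (max-not-after-third p)
... | x ∷ y ∷ []    , v , refl with max-third⇒head≡1+n p
...   | refl = third y v

IsWord : ℕ → ℕ → List ℕ → Set
IsWord n k l = length l ≡ k × All (_< n) l

IsWord-irrelevant : ∀ {n k l} → Irrelevant (IsWord n k l)
IsWord-irrelevant (len , bnd) (len′ , bnd′) =
  cong₂ _,_ (≡-irrelevant len len′) (All.irrelevant <-irrelevant bnd bnd′)

Σ-≡-irrelevant : ∀ {A : Set} {P : A → Set} → (∀ {a} → Irrelevant (P a)) →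
                 ∀ {x y : Σ A P} → proj₁ x ≡ proj₁ y → x ≡ y
Σ-≡-irrelevant irr {_ , p} {_ , q} refl = cong (_ ,_) (irr p q)

inClass : List ℕ → Bool
inClass l = distinct l ∧ avoids l (1 ∷ 2 ∷ 3 ∷ [])
                       ∧ avoids l (2 ∷ 1 ∷ 4 ∷ 3 ∷ [])
                       ∧ avoids l (3 ∷ 2 ∷ 1 ∷ 4 ∷ [])

-- Membership stays boolean so that an element of S n is determined by its list (S-≡);
-- InS is the propositional form used for reasoning.
S : ℕ → Set
S n = Σ (List ℕ) λ l → IsWord n n l × T (inClass l)

S-≡ : ∀ {n} {x y : S n} → proj₁ x ≡ proj₁ y → x ≡ y
S-≡ = Σ-≡-irrelevant λ (w , t) (w′ , t′) → cong₂ _,_ (IsWord-irrelevant w w′) (T-irrelevant t t′)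

IsWord∧inClass⇔InS : ∀ {n l} → (IsWord n n l × T (inClass l)) ⇔ InS n l
IsWord∧inClass⇔InS {n} {l} = mk⇔
  (λ ((len , bnd) , t) →
    let (d , t₁) = to T-∧ t ; (a₁ , t₂) = to T-∧ t₁ ; (a₂ , a₃) = to T-∧ t₂ in
    inS (permutation len bnd (to (distinct⇔Unique l) d))
        (to (avoids⇔Avoids l _) a₁ ∷ to (avoids⇔Avoids l _) a₂ ∷ to (avoids⇔Avoids l _) a₃ ∷ []))
  (λ { (inS (permutation len bnd uniq) (av₁ ∷ av₂ ∷ av₃ ∷ [])) →
    (len , bnd) , from T-∧ (from (distinct⇔Unique l) uniq ,
                  from T-∧ (from (avoids⇔Avoids l _) av₁ ,
                  from T-∧ (from (avoids⇔Avoids l _) av₂ , from (avoids⇔Avoids l _) av₃))) })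

module _ {n : ℕ} where

  private
    toInS : ∀ {m l} → IsWord m m l × T (inClass l) → InS m l
    toInS = to IsWord∧inClass⇔InS
    fromInS : ∀ {m l} → InS m l → IsWord m m l × T (inClass l)
    fromInS = from IsWord∧inClass⇔InS

  Parts : Set
  Parts = (S (2 + n) ⊎ S (2 + n)) ⊎ S (1 + n)

  glue : Parts → S (3 + n)
  glue (inj₁ (inj₁ (σ , p)))     = 2 + n ∷ σ , fromInS (InS-max-first (toInS p))
  glue (inj₁ (inj₂ (a ∷ σ , p))) = a ∷ 2 + n ∷ σ , fromInS (InS-max-second (toInS p))
  glue (inj₂ (b ∷ τ , p))        = 1 + n ∷ b ∷ 2 + n ∷ τ , fromInS (InS-max-third (toInS p))

  cut : ∀ {l} → MaxPosition n l → InS (3 + n) l → Parts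
  cut (first σ)    p = inj₁ (inj₁ (σ , fromInS (InS-delete [] p)))
  cut (second a σ) p = inj₁ (inj₂ (a ∷ σ , fromInS (InS-delete (a ∷ []) p)))
  cut (third b τ)  p = inj₂ (b ∷ τ , fromInS (InS-delete [] (InS-delete (1 + n ∷ b ∷ []) p)))

  split : S (3 + n) → Parts
  split (l , p) = cut (maxPosition (toInS p)) (toInS p)

  -- Quantified over every position, since maxPosition does not compute on glued lists.
  cut-glue : ∀ y (pos : MaxPosition n (proj₁ (glue y))) p → cut pos p ≡ y
  cut-glue (inj₁ (inj₁ _)) (first _) _ = cong (inj₁ ∘ inj₁) (S-≡ refl)
  cut-glue (inj₁ (inj₁ _)) (second _ _) (inS (permutation _ _ ((M≢M ∷ _) ∷ _)) _) =
    ⊥-elim (M≢M refl)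
  cut-glue (inj₁ (inj₂ (_ ∷ _ , (_ , M<M ∷ _) , _))) (first _) _ = ⊥-elim (<-irrefl refl M<M)
  cut-glue (inj₁ (inj₂ (_ ∷ _ , _))) (second _ _) _ = cong (inj₁ ∘ inj₂) (S-≡ refl)
  cut-glue (inj₁ (inj₂ (_ ∷ _ , _))) (third _ _) (inS (permutation _ _ (_ ∷ (M≢M ∷ _) ∷ _)) _) =
    ⊥-elim (M≢M refl)
  cut-glue (inj₂ (_ ∷ _ , (_ , M<1+n ∷ _) , _)) (second _ _) _ = ⊥-elim (<-asym M<1+n (n<1+n _))
  cut-glue (inj₂ (_ ∷ _ , _)) (third _ _) _ = cong inj₂ (S-≡ refl)

  glue-cut : ∀ {l} (pos : MaxPosition n l) p t → glue (cut pos p) ≡ (l , t)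
  glue-cut (first _)    _ _ = S-≡ refl
  glue-cut (second _ _) _ _ = S-≡ refl
  glue-cut (third _ _)  _ _ = S-≡ refl

  S-split : S (3 + n) ↔ Parts
  S-split = mk↔ₛ′ split glue (λ y → cut-glue y _ _) (λ (l , t) → glue-cut _ _ t)

Fin1↔S0 : Fin 1 ↔ S 0
Fin1↔S0 = mk↔ₛ′ (λ _ → [] , (refl , []) , _) (λ _ → zero)
  (λ { ([] , _) → S-≡ refl }) (λ { zero → refl })

Fin1↔S1 : Fin 1 ↔ S 1
Fin1↔S1 = mk↔ₛ′ (λ _ → 0 ∷ [] , (refl , s≤s z≤n ∷ []) , _) (λ _ → zero)
  (λ { (0 ∷ [] , _) → S-≡ refl ; (suc _ ∷ [] , (_ , s≤s () ∷ _) , _) }) (λ { zero → refl })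

Fin2↔S2 : Fin 2 ↔ S 2
Fin2↔S2 = mk↔ₛ′ word index word-index (λ { zero → refl ; (suc zero) → refl })
  where
  word : Fin 2 → S 2
  word zero    = 0 ∷ 1 ∷ [] , (refl , s≤s z≤n ∷ s≤s (s≤s z≤n) ∷ []) , _
  word (suc _) = 1 ∷ 0 ∷ [] , (refl , s≤s (s≤s z≤n) ∷ s≤s z≤n ∷ []) , _
  index : S 2 → Fin 2
  index (0 ∷ _ , _) = zero
  index _           = suc zero
  word-index : ∀ w → word (index w) ≡ w
  word-index (0 ∷ 1 ∷ [] , _) = S-≡ refl
  word-index (1 ∷ 0 ∷ [] , _) = S-≡ refl
  word-index (0 ∷ 0 ∷ [] , _ , ())
  word-index (1 ∷ 1 ∷ [] , _ , ())
  word-index (_ ∷ suc (suc _) ∷ [] , (_ , _ ∷ s≤s (s≤s ()) ∷ _) , _)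
  word-index (suc (suc _) ∷ _ ∷ [] , (_ , s≤s (s≤s ()) ∷ _) , _)

2*↔⊎ : ∀ m → Fin (2 * m) ↔ (Fin m ⊎ Fin m)
2*↔⊎ m =
  ↔-trans (+↔⊎ {m} {m + 0}) (↔-refl ⊎-↔ subst (λ k → Fin (m + 0) ↔ Fin k) (+-identityʳ m) ↔-refl)

pell↔S : ∀ n → Fin (pell n) ↔ S n
pell↔S zero                = Fin1↔S0
pell↔S (suc zero)          = Fin1↔S1
pell↔S (suc (suc zero))    = Fin2↔S2
pell↔S (suc (suc (suc n))) =
  ↔-trans (+↔⊎ {2 * pell (suc (suc n))})
    (↔-trans (↔-trans (2*↔⊎ _) (pell↔S (suc (suc n)) ⊎-↔ pell↔S (suc (suc n))) ⊎-↔ pell↔S (suc n))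
      (↔-sym S-split))

toℕs : ∀ {n k} → Vec (Fin n) k → List ℕ
toℕs v = map toℕ (toList v)

length-toℕs : ∀ {n k} (v : Vec (Fin n) k) → length (toℕs v) ≡ k
length-toℕs []      = refl
length-toℕs (_ ∷ v) = cong suc (length-toℕs v)

toℕs-bounded : ∀ {n k} (v : Vec (Fin n) k) → All (_< n) (toℕs v)
toℕs-bounded []      = []
toℕs-bounded (i ∷ v) = toℕ<n i ∷ toℕs-bounded v

fromℕs : ∀ {n} k l → IsWord n k l → Vec (Fin n) k
fromℕs zero    []      _                 = []
fromℕs (suc k) (x ∷ l) (len , x<n ∷ bnd) = fromℕ< x<n ∷ fromℕs k l (suc-injective len , bnd)

toℕs-fromℕs : ∀ {n} k l (w : IsWord n k l) → toℕs (fromℕs k l w) ≡ l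
toℕs-fromℕs zero    []      _                 = refl
toℕs-fromℕs (suc k) (x ∷ l) (len , x<n ∷ bnd) =
  cong₂ _∷_ (toℕ-fromℕ< x<n) (toℕs-fromℕs k l (suc-injective len , bnd))

fromℕs-toℕs : ∀ {n k} (v : Vec (Fin n) k) (w : IsWord n k (toℕs v)) → fromℕs k (toℕs v) w ≡ v
fromℕs-toℕs []      _                 = refl
fromℕs-toℕs (i ∷ v) (len , i<n ∷ bnd) =
  cong₂ _∷_ (fromℕ<-toℕ i i<n) (fromℕs-toℕs v (suc-injective len , bnd))

Vec↔Word : ∀ {n k} → Vec (Fin n) k ↔ Σ (List ℕ) (IsWord n k)
Vec↔Word {n} {k} =
  mk↔ₛ′ (λ v → toℕs v , length-toℕs v , toℕs-bounded v) (λ (l , w) → fromℕs k l w)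
    (λ (l , w) → Σ-≡-irrelevant IsWord-irrelevant (toℕs-fromℕs k l w))
    (λ v → fromℕs-toℕs v _)

inS-vectors↔S : ∀ n → Σ (Vec (Fin n) n) (λ v → T (inS-123-2143-3214 v)) ↔ S n
-- The fibres agree definitionally: inS-123-2143-3214 v unfolds to inClass (toℕs v).
inS-vectors↔S n = ↔-trans (Σ-↔ Vec↔Word ↔-refl) Σ-assoc-alt

mainTheorem4 : (n : ℕ) → Fin (pell n) ↔ Σ (Vec (Fin n) n) (λ v → T (inS-123-2143-3214 v))
mainTheorem4 n = ↔-trans (pell↔S n) (↔-sym (inS-vectors↔S n))
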